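{- Let $V=\mathbb F_q^{n+1}$ and let $\mathcal C(\Lambda_1)=\{c_M=(\mathrm{Tr}(X_1M),\dots,\mathrm{Tr}(X_NM)):M\in M_{n+1}(q)\}$ be the code associated to the projective system $\Lambda_1=\{[X_1],\dots,[X_N]\}$ of all points $[x\xi]$ with $x\in V$ a nonzero column vector, $\xi$ a nonzero row vector, $\xi x=0$. Let $M\in M_{n+1}(q)\setminus\langle I\rangle$ be such that $c_M$ is a maximum weight codeword and the minimal polynomial of $M$ is irreducible of degree $2$. Then the hyperplane $\mathcal H_M=\{([x],[\xi])\in\bar\Gamma:\xi Mx=0\}$ of $\bar\Gamma$ corresponding to $c_M$ is a spread-type hyperplane of $\bar\Gamma$.
   Context: $\bar\Gamma$ is the point-hyperplane geometry of $\mathrm{PG}(V)$: points are pairs $(p,H)$, $p$ a point and $H$ a hyperplane of $\mathrm{PG}(V)$ with $p\in H$ (written $([x],[\xi])$ with $\xi x=0$, $[\xi]$ the hyperplane $\ker\xi$). A line spread $S$ of $\mathrm{PG}(V)$ is a set of lines partitioning its points; it admits a dual $S^*$ if $S^*$ is a set of codimension-2 subspaces of $\mathrm{PG}(V)$ such that each hyperplane contains exactly one member of $S^*$ and, for every $L\in S^*$, the members of $S$ contained in $L$ partition $L$. A spread-type hyperplane of $\bar\Gamma$ is a set $\mathcal H_{(S,S^*)}=\{(p,H)\in\bar\Gamma:\ell_p\subseteq H\}$ where $S$ admits the dual $S^*$ and $\ell_p$ is the line of $S$ through $p$. -}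

module Defs where

open import Level using (0ℓ)
open import Data.Nat using (ℕ; zero; suc; _≤_)
open import Data.Fin using (Fin; zero; suc)
open import Data.Product using (Σ; ∃; ∃-syntax; _×_; _,_)
open import Data.Sum using (_⊎_)
open import Data.List using (List; []; _∷_; map; concatMap; length; filter)
open import Data.List.Membership.Propositional using (_∈_)
open import Data.List.Relation.Unary.Unique.Propositional using (Unique)
open import Relation.Binary.PropositionalEquality using (_≡_; _≢_)
open import Relation.Nullary using (¬_; Dec)
open import Relation.Binary using (DecidableEquality)
open import Algebra.Structures using (IsCommutativeRing)
open import Data.Empty using (⊥)
open import Relation.Nullary using (yes; no; ¬?)
open import Relation.Nullary.Decidable using (_×-dec_; _⊎-dec_)
open import Data.Vec.Functional using () renaming (_∷_ to _∷ᵥ_)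
import Data.Fin

-- Finite fields F_q (q = number of elements of the enumeration)

record FiniteField : Set₁ where
  infixl 6 _+_
  infixl 7 _*_
  field
    Carrier  : Set
    _+_ _*_  : Carrier → Carrier → Carrier
    -_       : Carrier → Carrier
    0# 1#    : Carrier
    isCommutativeRing : IsCommutativeRing _≡_ _+_ _*_ -_ 0# 1#
    0≢1      : 0# ≢ 1#
    inverse  : ∀ x → x ≢ 0# → ∃[ y ] (x * y ≡ 1#)
    _≟_      : DecidableEquality Carrier
    elements : List Carrier
    complete : ∀ x → x ∈ elements
    unique   : Unique elements

module Geometry (𝔽 : FiniteField) where
  open FiniteField 𝔽 renaming (Carrier to F)

  Vect : ℕ → Set
  Vect k = Fin k → F

  Mat : ℕ → Set
  Mat k = Fin k → Fin k → F

  Σ[_] : ∀ k → (Fin k → F) → F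
  Σ[ zero ]  f = 0#
  Σ[ suc k ] f = f zero + Σ[ k ] (λ i → f (suc i))

  _·_ : ∀ {k} → Vect k → Vect k → F
  _·_ {k} ξ x = Σ[ k ] (λ i → ξ i * x i)

  _▸_ : ∀ {k} → Mat k → Vect k → Vect k
  (M ▸ x) i = M i · x
  _⊗_ : ∀ {k} → Vect k → Vect k → Mat k
  (x ⊗ ξ) i j = x i * ξ j

  _∘ₘ_ : ∀ {k} → Mat k → Mat k → Mat k
  _∘ₘ_ {k} A B i j = Σ[ k ] (λ l → A i l * B l j)

  Tr : ∀ {k} → Mat k → F
  Tr {k} A = Σ[ k ] (λ i → A i i)

  idM : ∀ {k} → Mat k
  idM i j with i Data.Fin.≟ j
  ... | yes _ = 1#
  ... | no  _ = 0#

  _≈M_ : ∀ {k} → Mat k → Mat k → Set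
  A ≈M B = ∀ i j → A i j ≡ B i j

  _⋆_ : ∀ {k} → F → Mat k → Mat k
  (c ⋆ A) i j = c * A i j
  _⊕_ : ∀ {k} → Mat k → Mat k → Mat k
  (A ⊕ B) i j = A i j + B i j

  NonZero : ∀ {k} → Vect k → Set
  NonZero x = ∃[ i ] (x i ≢ 0#)

  -- Projective system Λ₁ and the code C(Λ₁)
  -- Each projective point of PG(V) (resp. of the dual) is represented by
  -- its unique normalised representative: first nonzero coordinate = 1.

  Normalised : ∀ k → Vect k → Set
  Normalised zero    v = ⊥
  Normalised (suc k) v = (v zero ≡ 1#) ⊎ (v zero ≡ 0# × Normalised k (λ i → v (suc i)))

  normalised? : ∀ k (v : Vect k) → Dec (Normalised k v)
  normalised? zero v = no (λ ())
  normalised? (suc k) v =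
    (v zero ≟ 1#) ⊎-dec ((v zero ≟ 0#) ×-dec (normalised? k (λ i → v (suc i))))

  allVects : ∀ k → List (Vect k)
  allVects zero    = (λ ()) ∷ []
  allVects (suc k) = concatMap (λ a → map (λ v → a ∷ᵥ v) (allVects k)) elements

  -- the points [X] = [x ξ] of Λ₁, listed once each via normalised x, ξ
  -- (the matrix x ξ determines x and ξ up to scalars)
  Λ₁-rep : ∀ k → Vect k × Vect k → Set
  Λ₁-rep k (x , ξ) = Normalised k x × Normalised k ξ × (ξ · x ≡ 0#)

  Λ₁-rep? : ∀ k (p : Vect k × Vect k) → Dec (Λ₁-rep k p)
  Λ₁-rep? k (x , ξ) =
    normalised? k x ×-dec (normalised? k ξ ×-dec ((ξ · x) ≟ 0#))

  Λ₁ : ∀ k → List (Vect k × Vect k)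
  Λ₁ k = filter (Λ₁-rep? k) (concatMap (λ x → map (λ ξ → (x , ξ)) (allVects k)) (allVects k))

  points : ∀ k → List (Mat k)
  points k = map (λ { (x , ξ) → x ⊗ ξ }) (Λ₁ k)

  codeword : ∀ {k} → Mat k → List F
  codeword {k} M = map (λ X → Tr (X ∘ₘ M)) (points k)

  wt : List F → ℕ
  wt c = length (filter (λ a → ¬? (a ≟ 0#)) c)

  MaxWeight : ∀ {k} → Mat k → Set
  MaxWeight {k} M = ∀ (M' : Mat k) → wt (codeword M') ≤ wt (codeword M)

  NotScalar : ∀ {k} → Mat k → Set
  NotScalar M = ∀ c → ¬ (M ≈M (c ⋆ idM))

  -- the minimal polynomial of M is t² - a t - b: it annihilates M and no
  -- monic polynomial of smaller degree (1 or t - c) annihilates M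
  -- (for k ≥ 1, the constant 1 never annihilates M).
  MinPolyIs : ∀ {k} → Mat k → F → F → Set
  MinPolyIs M a b = ((M ∘ₘ M) ≈M ((a ⋆ M) ⊕ (b ⋆ idM))) × NotScalar M

  -- t² - a t - b is irreducible: it is not a product of two polynomials of
  -- degree 1 (w.l.o.g. monic) (t - c)(t - d) = t² - (c+d) t + c d
  IrreducibleQuadratic : F → F → Set
  IrreducibleQuadratic a b = ¬ (∃[ c ] ∃[ d ] ((c + d ≡ a) × (c * d ≡ - b)))

  MinPolyIrreducibleDeg2 : ∀ {k} → Mat k → Set
  MinPolyIrreducibleDeg2 M = ∃[ a ] ∃[ b ] (MinPolyIs M a b × IrreducibleQuadratic a b)

  lin : ∀ {k} → F → Vect k → F → Vect k → Vect k
  lin α u β v i = α * u i + β * v i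

  Independent : ∀ {k} → Vect k → Vect k → Set
  Independent u v = ∀ α β → (∀ i → lin α u β v i ≡ 0#) → (α ≡ 0#) × (β ≡ 0#)

  record Line (k : ℕ) : Set where
    constructor line
    field u v : Vect k
          indep : Independent u v

  record Codim2 (k : ℕ) : Set where
    constructor codim2
    field η₁ η₂ : Vect k
          indep : Independent η₁ η₂

  _∈L_ : ∀ {k} → Vect k → Line k → Set
  x ∈L line u v _ = ∃[ α ] ∃[ β ] (∀ i → x i ≡ lin α u β v i)

  _∈C_ : ∀ {k} → Vect k → Codim2 k → Set
  x ∈C codim2 η₁ η₂ _ = (η₁ · x ≡ 0#) × (η₂ · x ≡ 0#)

  _∈H_ : ∀ {k} → Vect k → Vect k → Set
  x ∈H ξ = ξ · x ≡ 0#

  _≡L_ : ∀ {k} → Line k → Line k → Set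
  ℓ ≡L m = ∀ x → (x ∈L ℓ → x ∈L m) × (x ∈L m → x ∈L ℓ)

  _≡C_ : ∀ {k} → Codim2 k → Codim2 k → Set
  L ≡C L' = ∀ x → (x ∈C L → x ∈C L') × (x ∈C L' → x ∈C L)

  _⊆LC_ : ∀ {k} → Line k → Codim2 k → Set
  ℓ ⊆LC L = ∀ x → x ∈L ℓ → x ∈C L

  _⊆LH_ : ∀ {k} → Line k → Vect k → Set
  ℓ ⊆LH ξ = ∀ x → x ∈L ℓ → x ∈H ξ

  _⊆CH_ : ∀ {k} → Codim2 k → Vect k → Set
  L ⊆CH ξ = ∀ x → x ∈C L → x ∈H ξ

  IsLineSpread : ∀ {k} → (Line k → Set) → Set
  IsLineSpread {k} S =
    (∀ (x : Vect k) → NonZero x → ∃[ ℓ ] (S ℓ × x ∈L ℓ)) ×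
    (∀ ℓ m (x : Vect k) → S ℓ → S m → NonZero x → x ∈L ℓ → x ∈L m → ℓ ≡L m)

  IsDual : ∀ {k} → (Line k → Set) → (Codim2 k → Set) → Set
  IsDual {k} S S* =
    (∀ (ξ : Vect k) → NonZero ξ → ∃[ L ] (S* L × L ⊆CH ξ)) ×
    (∀ (ξ : Vect k) L L' → NonZero ξ → S* L → S* L' → L ⊆CH ξ → L' ⊆CH ξ → L ≡C L') ×
    (∀ L (x : Vect k) → S* L → NonZero x → x ∈C L → ∃[ ℓ ] (S ℓ × ℓ ⊆LC L × x ∈L ℓ))

  PointΓ : ∀ {k} → Vect k → Vect k → Set
  PointΓ x ξ = NonZero x × NonZero ξ × (ξ · x ≡ 0#)

  InSpreadType : ∀ {k} → (Line k → Set) → Vect k → Vect k → Set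
  InSpreadType S x ξ = ∀ ℓ → S ℓ → x ∈L ℓ → ℓ ⊆LH ξ

  InHM : ∀ {k} → Mat k → Vect k → Vect k → Set
  InHM M x ξ = ξ · (M ▸ x) ≡ 0#

  IsSpreadTypeHyperplane : ∀ {k} → (Vect k → Vect k → Set) → Set₁
  IsSpreadTypeHyperplane {k} 𝓗 =
    ∃[ S ] ∃[ S* ] (IsLineSpread {k} S × IsDual S S* ×
      (∀ x ξ → PointΓ x ξ → (𝓗 x ξ → InSpreadType S x ξ) × (InSpreadType S x ξ → 𝓗 x ξ)))

{-# OPTIONS --safe #-}
-- Write θ for a root of t² - a t - b, so that M² = a M + b I.  For x ≠ 0 the vectors x, M x
-- span a line ⟨x, M x⟩, and every nonzero y = α x + β M x on it spans the same line: the
-- change of basis from (x, M x) to (y, M y) has determinant the norm α² + a α β - b β² of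
-- α + β θ, which vanishes only when α = β = 0 because t² - a t - b is irreducible.  So these
-- lines form a spread S.  The same argument for row vectors under ξ ↦ ξ M shows that the
-- subspaces ker ξ ∩ ker ξ M form S*: if [ξ] contains ker η ∩ ker η M, then ξ lies in
-- ⟨η, η M⟩, hence ⟨ξ, ξ M⟩ = ⟨η, η M⟩ and ker ξ ∩ ker ξ M = ker η ∩ ker η M; and these
-- subspaces are M-invariant, so they are unions of lines of S.  Finally, if ξ x = 0 then ξ
-- vanishes on ⟨x, M x⟩ exactly when ξ M x = 0.
module Submission where

open import Defs
open import Data.Nat using (ℕ; zero; suc)

open import Level using (0ℓ)
open import Algebra.Bundles using (CommutativeRing)
open import Algebra.Solver.Ring.AlmostCommutativeRing
  using (fromCommutativeRing; _-Raw-AlmostCommutative⟶_)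
import Data.Nat as ℕ
import Data.Nat.Properties as ℕ
open import Data.Integer as ℤ using (ℤ; -[1+_]; _⊖_; _◃_)
import Data.Integer.Properties as ℤ
open import Data.Sign as Sign using (Sign)
import Data.Maybe as Maybe
open import Data.Fin as Fin using (Fin; zero; suc)
open import Data.Fin.Properties using (¬∀⟶∃¬; suc-injective)
open import Data.Product using (∃-syntax; _×_; _,_; proj₁; proj₂)
open import Function using (_∘_)
open import Relation.Binary.PropositionalEquality
open import Relation.Nullary using (¬_; yes; no; contradiction)
open import Relation.Nullary.Decidable using (dec⇒maybe)
open import Relation.Unary using (Pred; _⊆_; _≐_)
open import Relation.Unary.Properties using (≐-sym; ≐-trans)

-- The ring solver needs coefficients whose equality computes, so F is given ℤ coefficients
-- through the map ℤ → F.  With the TC-optimised multiple, 1 ×ₙ 1# is 1# by definition, so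
-- con (ℤ.+ 1) means exactly 1#.
module FieldSolver (𝔽 : FiniteField) where
  open FiniteField 𝔽 renaming (Carrier to F)

  commutativeRing : CommutativeRing 0ℓ 0ℓ
  commutativeRing = record { isCommutativeRing = isCommutativeRing }

  open CommutativeRing commutativeRing
    using (semiring; ring; +-assoc; +-comm; +-identityˡ; +-identityʳ; -‿inverseˡ; -‿inverseʳ)
  open import Algebra.Properties.Semiring.Mult.TCOptimised semiring
    using (1+×; ×-homo-+; ×1-homo-*) renaming (_×_ to _×ₙ_)
  open import Algebra.Properties.Ring ring
    using (-‿distribˡ-*; -‿distribʳ-*; -0#≈0#; -‿involutive; -‿+-comm)
  open ≡-Reasoning

  ℤ→F : ℤ → F
  ℤ→F (ℤ.+ n)  = n ×ₙ 1#
  ℤ→F -[1+ n ] = - (suc n ×ₙ 1#)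

  ℤ→F-⊖ : ∀ m n → ℤ→F (m ⊖ n) ≡ m ×ₙ 1# + - (n ×ₙ 1#)
  ℤ→F-⊖ zero    zero    = sym (-‿inverseʳ 0#)
  ℤ→F-⊖ (suc m) zero    = sym (trans (cong ((suc m ×ₙ 1#) +_) -0#≈0#) (+-identityʳ _))
  ℤ→F-⊖ zero    (suc n) = sym (+-identityˡ _)
  ℤ→F-⊖ (suc m) (suc n) = begin
    ℤ→F (suc m ⊖ suc n)                       ≡⟨ cong ℤ→F (ℤ.[1+m]⊖[1+n]≡m⊖n m n) ⟩
    ℤ→F (m ⊖ n)                               ≡⟨ ℤ→F-⊖ m n ⟩
    x + - y                                   ≡⟨ cong (_+ - y) (+-identityˡ x) ⟨
    (0# + x) + - y                            ≡⟨ cong (λ z → (z + x) + - y) (-‿inverseˡ 1#) ⟨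
    ((- 1# + 1#) + x) + - y                   ≡⟨ cong (_+ - y) (+-assoc (- 1#) 1# x) ⟩
    (- 1# + (1# + x)) + - y                   ≡⟨ cong (_+ - y) (+-comm (- 1#) (1# + x)) ⟩
    ((1# + x) + - 1#) + - y                   ≡⟨ +-assoc (1# + x) (- 1#) (- y) ⟩
    (1# + x) + (- 1# + - y)                   ≡⟨ cong ((1# + x) +_) (-‿+-comm 1# y) ⟩
    (1# + x) + - (1# + y)                     ≡⟨ cong₂ (λ s t → s + - t) (1+× m 1#) (1+× n 1#) ⟨
    suc m ×ₙ 1# + - (suc n ×ₙ 1#)             ∎
    where
    x y : F
    x = m ×ₙ 1#
    y = n ×ₙ 1#

  ℤ→F-+ : ∀ i j → ℤ→F (i ℤ.+ j) ≡ ℤ→F i + ℤ→F j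
  ℤ→F-+ (ℤ.+ m)  (ℤ.+ n)  = ×-homo-+ 1# m n
  ℤ→F-+ (ℤ.+ m)  -[1+ n ] = ℤ→F-⊖ m (suc n)
  ℤ→F-+ -[1+ m ] (ℤ.+ n)  = trans (ℤ→F-⊖ n (suc m)) (+-comm _ _)
  ℤ→F-+ -[1+ m ] -[1+ n ] = begin
    - (suc (suc (m ℕ.+ n)) ×ₙ 1#)             ≡⟨ cong (λ l → - (suc l ×ₙ 1#)) (ℕ.+-suc m n) ⟨
    - ((suc m ℕ.+ suc n) ×ₙ 1#)               ≡⟨ cong -_ (×-homo-+ 1# (suc m) (suc n)) ⟩
    - (suc m ×ₙ 1# + suc n ×ₙ 1#)             ≡⟨ -‿+-comm _ _ ⟨
    - (suc m ×ₙ 1#) + - (suc n ×ₙ 1#)         ∎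

  signed : Sign → F → F
  signed Sign.+ x = x
  signed Sign.- x = - x

  signed-* : ∀ s t x y → signed (s Sign.* t) (x * y) ≡ signed s x * signed t y
  signed-* Sign.+ Sign.+ x y = refl
  signed-* Sign.+ Sign.- x y = -‿distribʳ-* x y
  signed-* Sign.- Sign.+ x y = -‿distribˡ-* x y
  signed-* Sign.- Sign.- x y = begin
    x * y          ≡⟨ -‿involutive (x * y) ⟨
    - - (x * y)    ≡⟨ cong -_ (-‿distribˡ-* x y) ⟩
    - (- x * y)    ≡⟨ -‿distribʳ-* (- x) y ⟩
    - x * - y      ∎

  ℤ→F-◃ : ∀ s n → ℤ→F (s ◃ n) ≡ signed s (n ×ₙ 1#)
  ℤ→F-◃ Sign.+ zero    = refl
  ℤ→F-◃ Sign.- zero    = sym -0#≈0#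
  ℤ→F-◃ Sign.+ (suc n) = refl
  ℤ→F-◃ Sign.- (suc n) = refl

  ℤ→F-signAbs : ∀ i → ℤ→F i ≡ signed (ℤ.sign i) (ℤ.∣ i ∣ ×ₙ 1#)
  ℤ→F-signAbs (ℤ.+ n)  = refl
  ℤ→F-signAbs -[1+ n ] = refl

  ℤ→F-* : ∀ i j → ℤ→F (i ℤ.* j) ≡ ℤ→F i * ℤ→F j
  ℤ→F-* i j = begin
    ℤ→F ((s Sign.* t) ◃ (∣i∣ ℕ.* ∣j∣))       ≡⟨ ℤ→F-◃ (s Sign.* t) (∣i∣ ℕ.* ∣j∣) ⟩
    signed (s Sign.* t) ((∣i∣ ℕ.* ∣j∣) ×ₙ 1#) ≡⟨ cong (signed (s Sign.* t)) (×1-homo-* ∣i∣ ∣j∣) ⟩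
    signed (s Sign.* t) (∣i∣ ×ₙ 1# * ∣j∣ ×ₙ 1#) ≡⟨ signed-* s t _ _ ⟩
    signed s (∣i∣ ×ₙ 1#) * signed t (∣j∣ ×ₙ 1#) ≡⟨ cong₂ _*_ (ℤ→F-signAbs i) (ℤ→F-signAbs j) ⟨
    ℤ→F i * ℤ→F j                            ∎
    where
    s t : Sign
    s = ℤ.sign i
    t = ℤ.sign j
    ∣i∣ ∣j∣ : ℕ
    ∣i∣ = ℤ.∣ i ∣
    ∣j∣ = ℤ.∣ j ∣

  ℤ→F-neg : ∀ i → ℤ→F (ℤ.- i) ≡ - ℤ→F i
  ℤ→F-neg (ℤ.+ zero) = sym -0#≈0#
  ℤ→F-neg ℤ.+[1+ n ] = refl
  ℤ→F-neg -[1+ n ]   = sym (-‿involutive _)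

  ℤ→F-homomorphism : ℤ.+-*-rawRing -Raw-AlmostCommutative⟶ fromCommutativeRing commutativeRing
  ℤ→F-homomorphism = record
    { ⟦_⟧ = ℤ→F ; +-homo = ℤ→F-+ ; *-homo = ℤ→F-* ; -‿homo = ℤ→F-neg ; 0-homo = refl ; 1-homo = refl }

  open import Algebra.Solver.Ring ℤ.+-*-rawRing (fromCommutativeRing commutativeRing) ℤ→F-homomorphism
    (λ i j → Maybe.map (cong ℤ→F) (dec⇒maybe (i ℤ.≟ j)))
    public using (solve; _:=_; _:+_; _:*_; :-_; con)


module _ (𝔽 : FiniteField) where
  open FiniteField 𝔽 renaming (Carrier to F)
  open Geometry 𝔽
  open FieldSolver 𝔽
  open CommutativeRing commutativeRing
    using (semiring; ring; *-comm; *-assoc; *-identityˡ; *-identityʳ; zeroˡ; zeroʳ; +-identityˡ; +-identityʳ)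
  open import Algebra.Properties.Ring ring using (x∙y⁻¹≈ε⇒x≈y)
  open import Algebra.Properties.Semiring.Sum semiring
    using (sum; sum-cong-≗; sum-replicate-zero; ∑-distrib-+; ∑-comm; *-distribˡ-sum; *-distribʳ-sum)
  open ≡-Reasoning

  private
    variable
      k : ℕ
      a b α β : F
      u v v′ x y ξ ξ′ η₁ η₂ η₁′ η₂′ : Vect k

  x*y≡0⇒x≡0 : ∀ {s t} → s * t ≡ 0# → t ≢ 0# → s ≡ 0#
  x*y≡0⇒x≡0 {s} {t} st≡0 t≢0 with inverse t t≢0
  ... | t⁻¹ , tt⁻¹≡1 = begin
    s              ≡⟨ *-identityʳ s ⟨
    s * 1#         ≡⟨ cong (s *_) tt⁻¹≡1 ⟨
    s * (t * t⁻¹)  ≡⟨ *-assoc s t t⁻¹ ⟨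
    (s * t) * t⁻¹  ≡⟨ cong (_* t⁻¹) st≡0 ⟩
    0# * t⁻¹       ≡⟨ zeroˡ t⁻¹ ⟩
    0#             ∎

  x*x≡0⇒x≡0 : ∀ {s} → s * s ≡ 0# → s ≡ 0#
  x*x≡0⇒x≡0 {s} s²≡0 with s ≟ 0#
  ... | yes s≡0 = s≡0
  ... | no  s≢0 = x*y≡0⇒x≡0 s²≡0 s≢0

  -- The norm N(α + β θ) for a root θ of t² - a t - b.
  norm : F → F → F → F → F
  norm a b α β = α * (α + β * a) + - (β * (β * b))

  module _ {a b : F} (irreducible : IrreducibleQuadratic a b) where

    irreducible⇒no-root : ∀ c → c * c ≢ a * c + b
    irreducible⇒no-root c c²≡ac+b = irreducible (c , a + - c , c+d≡a , cd≡-b)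
      where
      c+d≡a : c + (a + - c) ≡ a
      c+d≡a = solve 2 (λ c a → c :+ (a :+ :- c) := a) refl c a
      cd≡-b : c * (a + - c) ≡ - b
      cd≡-b = begin
        c * (a + - c)          ≡⟨ solve 2 (λ c a → c :* (a :+ :- c) := a :* c :+ :- (c :* c)) refl c a ⟩
        a * c + - (c * c)      ≡⟨ cong (λ s → a * c + - s) c²≡ac+b ⟩
        a * c + - (a * c + b)  ≡⟨ solve 3 (λ a c b → a :* c :+ :- (a :* c :+ b) := :- b) refl a c b ⟩
        - b                    ∎

    norm≡0⇒trivial : norm a b α β ≡ 0# → α ≡ 0# × β ≡ 0#
    norm≡0⇒trivial {α} {β} N≡0 with β ≟ 0#
    ... | yes refl = x*x≡0⇒x≡0 α²≡0 , refl
      where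
      α²≡0 : α * α ≡ 0#
      α²≡0 = trans (solve 3 (λ α a b → α :* α
                                   := α :* (α :+ con (ℤ.+ 0) :* a) :+ :- (con (ℤ.+ 0) :* (con (ℤ.+ 0) :* b)))
                             refl α a b)
                   N≡0
    ... | no β≢0 with inverse β β≢0
    ...   | β⁻¹ , ββ⁻¹≡1 = contradiction c²≡ac+b (irreducible⇒no-root c)
      where
      -- c = -α/β satisfies c² - a c - b = β⁻² N(α + β θ) = 0.
      c : F
      c = - (α * β⁻¹)
      c²≡ac+b : c * c ≡ a * c + b
      c²≡ac+b = x∙y⁻¹≈ε⇒x≈y _ _ (begin
        c * c + - (a * c + b)
          ≡⟨ solve 3 (λ c a b → c :* c :+ :- (a :* c :+ b)
                              := c :* c :+ :- (a :* c :* con (ℤ.+ 1) :+ b :* (con (ℤ.+ 1) :* con (ℤ.+ 1))))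
                     refl c a b ⟩
        c * c + - (a * c * 1# + b * (1# * 1#))
          ≡⟨ cong (λ t → c * c + - (a * c * t + b * (t * t))) ββ⁻¹≡1 ⟨
        c * c + - (a * c * (β * β⁻¹) + b * ((β * β⁻¹) * (β * β⁻¹)))
          ≡⟨ solve 5 (λ α β β⁻¹ a b → let c = :- (α :* β⁻¹) in
                        c :* c :+ :- (a :* c :* (β :* β⁻¹) :+ b :* ((β :* β⁻¹) :* (β :* β⁻¹)))
                        := (β⁻¹ :* β⁻¹) :* (α :* (α :+ β :* a) :+ :- (β :* (β :* b)))) refl α β β⁻¹ a b ⟩
        (β⁻¹ * β⁻¹) * norm a b α β
          ≡⟨ cong ((β⁻¹ * β⁻¹) *_) N≡0 ⟩
        (β⁻¹ * β⁻¹) * 0#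
          ≡⟨ zeroʳ _ ⟩
        0# ∎)

  0ᵥ : Vect k
  0ᵥ _ = 0#

  NonZero⇒≢0ᵥ : NonZero x → ¬ (x ≗ 0ᵥ)
  NonZero⇒≢0ᵥ (i , xᵢ≢0) x≗0 = xᵢ≢0 (x≗0 i)

  ≢0ᵥ⇒NonZero : ¬ (x ≗ 0ᵥ) → NonZero x
  ≢0ᵥ⇒NonZero {k} {x} = ¬∀⟶∃¬ k (λ i → x i ≡ 0#) (λ i → x i ≟ 0#)

  zero-combination : ∀ γ δ {s t} → s ≡ 0# → t ≡ 0# → γ * s + δ * t ≡ 0#
  zero-combination γ δ refl refl =
    solve 2 (λ γ δ → γ :* con (ℤ.+ 0) :+ δ :* con (ℤ.+ 0) := con (ℤ.+ 0)) refl γ δ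

  lin-1-0 : ∀ (u v : Vect k) → lin 1# u 0# v ≗ u
  lin-1-0 u v i = solve 2 (λ x y → con (ℤ.+ 1) :* x :+ con (ℤ.+ 0) :* y := x) refl (u i) (v i)

  lin-0-1 : ∀ (u v : Vect k) → lin 0# u 1# v ≗ v
  lin-0-1 u v i = solve 2 (λ x y → con (ℤ.+ 0) :* x :+ con (ℤ.+ 1) :* y := y) refl (u i) (v i)

  lin-0-0 : ∀ (u v : Vect k) → lin 0# u 0# v ≗ 0ᵥ
  lin-0-0 u v i = solve 2 (λ x y → con (ℤ.+ 0) :* x :+ con (ℤ.+ 0) :* y := con (ℤ.+ 0)) refl (u i) (v i)

  Σ≡sum : ∀ k (f : Fin k → F) → Σ[ k ] f ≡ sum f
  Σ≡sum zero    f = refl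
  Σ≡sum (suc k) f = cong (f zero +_) (Σ≡sum k (f ∘ suc))

  Σ-cong : ∀ {f g : Fin k → F} → f ≗ g → Σ[ k ] f ≡ Σ[ k ] g
  Σ-cong {k} f≗g = trans (Σ≡sum k _) (trans (sum-cong-≗ f≗g) (sym (Σ≡sum k _)))

  sum-zero : ∀ (f : Fin k → F) → f ≗ 0ᵥ → sum f ≡ 0#
  sum-zero {k} f f≗0 = trans (sum-cong-≗ f≗0) (sum-replicate-zero k)

  sum-δ : ∀ (f : Fin k → F) i → (∀ j → j ≢ i → f j ≡ 0#) → sum f ≡ f i
  sum-δ {suc k} f zero f≡0 = begin
    f zero + sum (f ∘ suc)   ≡⟨ cong (f zero +_) (sum-zero (f ∘ suc) (λ j → f≡0 (suc j) λ ())) ⟩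
    f zero + 0#              ≡⟨ +-identityʳ (f zero) ⟩
    f zero                   ∎
  sum-δ {suc k} f (suc i) f≡0 = begin
    f zero + sum (f ∘ suc)   ≡⟨ cong (_+ sum (f ∘ suc)) (f≡0 zero λ ()) ⟩
    0# + sum (f ∘ suc)       ≡⟨ +-identityˡ _ ⟩
    sum (f ∘ suc)            ≡⟨ sum-δ (f ∘ suc) i (λ j j≢i → f≡0 (suc j) (j≢i ∘ suc-injective)) ⟩
    f (suc i)                ∎

  ·-cong : ξ ≗ ξ′ → x ≗ y → ξ · x ≡ ξ′ · y
  ·-cong ξ≗ξ′ x≗y = Σ-cong (λ i → cong₂ _*_ (ξ≗ξ′ i) (x≗y i))

  ·-comm : ∀ (ξ x : Vect k) → ξ · x ≡ x · ξ
  ·-comm ξ x = Σ-cong (λ i → *-comm (ξ i) (x i))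

  ·-linʳ : ∀ (ξ : Vect k) α u β v → ξ · lin α u β v ≡ α * (ξ · u) + β * (ξ · v)
  ·-linʳ {k} ξ α u β v = begin
    ξ · lin α u β v
      ≡⟨ Σ-cong (λ i → solve 5 (λ x a y b z → x :* (a :* y :+ b :* z) := a :* (x :* y) :+ b :* (x :* z))
                                refl (ξ i) α (u i) β (v i)) ⟩
    Σ[ k ] (λ i → α * (ξ i * u i) + β * (ξ i * v i))
      ≡⟨ Σ≡sum k _ ⟩
    sum (λ i → α * (ξ i * u i) + β * (ξ i * v i))
      ≡⟨ ∑-distrib-+ (λ i → α * (ξ i * u i)) (λ i → β * (ξ i * v i)) ⟩
    sum (λ i → α * (ξ i * u i)) + sum (λ i → β * (ξ i * v i))
      ≡⟨ cong₂ _+_ (*-distribˡ-sum α (λ i → ξ i * u i)) (*-distribˡ-sum β (λ i → ξ i * v i)) ⟨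
    α * sum (λ i → ξ i * u i) + β * sum (λ i → ξ i * v i)
      ≡⟨ cong₂ (λ s t → α * s + β * t) (Σ≡sum k _) (Σ≡sum k _) ⟨
    α * (ξ · u) + β * (ξ · v) ∎

  ·-linˡ : ∀ α (ξ : Vect k) β η x → lin α ξ β η · x ≡ α * (ξ · x) + β * (η · x)
  ·-linˡ α ξ β η x = begin
    lin α ξ β η · x            ≡⟨ ·-comm _ x ⟩
    x · lin α ξ β η            ≡⟨ ·-linʳ x α ξ β η ⟩
    α * (x · ξ) + β * (x · η)  ≡⟨ cong₂ (λ s t → α * s + β * t) (·-comm x ξ) (·-comm x η) ⟩
    α * (ξ · x) + β * (η · x)  ∎

  ·-unit : ∀ (ξ e : Vect k) i → e i ≡ 1# → (∀ j → j ≢ i → e j ≡ 0#) → ξ · e ≡ ξ i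
  ·-unit {k} ξ e i eᵢ≡1 e≡0 = begin
    ξ · e                  ≡⟨ Σ≡sum k _ ⟩
    sum (λ j → ξ j * e j)  ≡⟨ sum-δ _ i (λ j j≢i → trans (cong (ξ j *_) (e≡0 j j≢i)) (zeroʳ (ξ j))) ⟩
    ξ i * e i              ≡⟨ cong (ξ i *_) eᵢ≡1 ⟩
    ξ i * 1#               ≡⟨ *-identityʳ (ξ i) ⟩
    ξ i                    ∎

  idM-diagonal : ∀ (i : Fin k) → idM i i ≡ 1#
  idM-diagonal i with i Fin.≟ i
  ... | yes _   = refl
  ... | no  i≢i = contradiction refl i≢i

  idM-offDiagonal : ∀ {i j : Fin k} → i ≢ j → idM i j ≡ 0#
  idM-offDiagonal {i = i} {j} i≢j with i Fin.≟ j
  ... | yes i≡j = contradiction i≡j i≢j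
  ... | no  _   = refl

  col : Mat k → Fin k → Vect k
  col A j i = A i j

  ·-idM : ∀ (ξ : Vect k) i → ξ · idM i ≡ ξ i
  ·-idM ξ i = ·-unit ξ (idM i) i (idM-diagonal i) (λ j j≢i → idM-offDiagonal (j≢i ∘ sym))

  ·-col-idM : ∀ (ξ : Vect k) j → ξ · col idM j ≡ ξ j
  ·-col-idM ξ j = ·-unit ξ (col idM j) j (idM-diagonal j) (λ i i≢j → idM-offDiagonal i≢j)

  _◂_ : Vect k → Mat k → Vect k
  (ξ ◂ A) j = ξ · col A j

  ▸-cong : ∀ (A : Mat k) → x ≗ y → A ▸ x ≗ A ▸ y
  ▸-cong A x≗y i = ·-cong (λ _ → refl) x≗y

  ◂-cong : ∀ (A : Mat k) → ξ ≗ ξ′ → ξ ◂ A ≗ ξ′ ◂ A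
  ◂-cong A ξ≗ξ′ j = ·-cong ξ≗ξ′ (λ _ → refl)

  ▸-lin : ∀ (A : Mat k) α u β v → A ▸ lin α u β v ≗ lin α (A ▸ u) β (A ▸ v)
  ▸-lin A α u β v i = ·-linʳ (A i) α u β v

  ◂-lin : ∀ (A : Mat k) α ξ β η → lin α ξ β η ◂ A ≗ lin α (ξ ◂ A) β (η ◂ A)
  ◂-lin A α ξ β η j = ·-linˡ α ξ β η (col A j)

  ·▸≡◂· : ∀ (ξ : Vect k) A x → ξ · (A ▸ x) ≡ (ξ ◂ A) · x
  ·▸≡◂· {k} ξ A x = begin
    ξ · (A ▸ x)
      ≡⟨ Σ-cong (λ i → cong (ξ i *_) (Σ≡sum k _)) ⟩
    Σ[ k ] (λ i → ξ i * sum (λ j → A i j * x j))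
      ≡⟨ Σ≡sum k _ ⟩
    sum (λ i → ξ i * sum (λ j → A i j * x j))
      ≡⟨ sum-cong-≗ (λ i → *-distribˡ-sum (ξ i) (λ j → A i j * x j)) ⟩
    sum (λ i → sum (λ j → ξ i * (A i j * x j)))
      ≡⟨ ∑-comm (λ i j → ξ i * (A i j * x j)) ⟩
    sum (λ j → sum (λ i → ξ i * (A i j * x j)))
      ≡⟨ sum-cong-≗ (λ j → trans (sum-cong-≗ (λ i → sym (*-assoc (ξ i) (A i j) (x j))))
                                 (sym (*-distribʳ-sum (x j) (λ i → ξ i * A i j)))) ⟩
    sum (λ j → sum (λ i → ξ i * A i j) * x j)
      ≡⟨ sum-cong-≗ (λ j → cong (_* x j) (Σ≡sum k _)) ⟨
    sum (λ j → (ξ ◂ A) j * x j)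
      ≡⟨ Σ≡sum k _ ⟨
    (ξ ◂ A) · x ∎

  module _ {A : Mat k} (A² : (A ∘ₘ A) ≈M ((a ⋆ A) ⊕ (b ⋆ idM))) where

    ▸-quadratic : ∀ u → A ▸ (A ▸ u) ≗ lin a (A ▸ u) b u
    ▸-quadratic u i = begin
      A i · (A ▸ u)                    ≡⟨ ·▸≡◂· (A i) A u ⟩
      (A i ◂ A) · u                    ≡⟨ ·-cong (A² i) (λ _ → refl) ⟩
      lin a (A i) b (idM i) · u        ≡⟨ ·-linˡ a (A i) b (idM i) u ⟩
      a * (A i · u) + b * (idM i · u)  ≡⟨ cong (λ s → a * (A i · u) + b * s)
                                                (trans (·-comm (idM i) u) (·-idM u i)) ⟩
      a * (A i · u) + b * u i          ∎

    ◂-quadratic : ∀ ξ → (ξ ◂ A) ◂ A ≗ lin a (ξ ◂ A) b ξ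
    ◂-quadratic ξ j = begin
      (ξ ◂ A) · col A j                        ≡⟨ ·▸≡◂· ξ A (col A j) ⟨
      ξ · (A ▸ col A j)                        ≡⟨ ·-cong (λ _ → refl) (λ i → A² i j) ⟩
      ξ · lin a (col A j) b (col idM j)        ≡⟨ ·-linʳ ξ a (col A j) b (col idM j) ⟩
      a * (ξ · col A j) + b * (ξ · col idM j)  ≡⟨ cong (λ s → a * (ξ · col A j) + b * s) (·-col-idM ξ j) ⟩
      a * (ξ ◂ A) j + b * ξ j                  ∎

  Span : Vect k → Vect k → Pred (Vect k) 0ℓ
  Span u v y = ∃[ γ ] ∃[ δ ] (y ≗ lin γ u δ v)

  Kernel : Vect k → Vect k → Pred (Vect k) 0ℓ
  Kernel η₁ η₂ x = x ∈H η₁ × x ∈H η₂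

  ≐⇒pointwise : ∀ {P Q : Pred (Vect k) 0ℓ} → P ≐ Q → ∀ x → (P x → Q x) × (Q x → P x)
  ≐⇒pointwise (P⊆Q , Q⊆P) _ = P⊆Q , Q⊆P

  Span-fst : Span u v u
  Span-fst {u = u} {v} = 1# , 0# , λ i → sym (lin-1-0 u v i)

  Span-snd : Span u v v
  Span-snd {u = u} {v} = 0# , 1# , λ i → sym (lin-0-1 u v i)

  Span-congʳ : v ≗ v′ → Span u v ≐ Span u v′
  Span-congʳ {u = u} v≗v′ = replace v≗v′ , replace (sym ∘ v≗v′)
    where
    replace : ∀ {w w′} → w ≗ w′ → Span u w ⊆ Span u w′
    replace w≗w′ (γ , δ , y≗) = γ , δ , λ i → trans (y≗ i) (cong (λ s → γ * u i + δ * s) (w≗w′ i))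

  Span⊆Span : Span u v x → Span u v y → Span x y ⊆ Span u v
  Span⊆Span {u = u} {v} (α₁ , β₁ , x≗) (α₂ , β₂ , y≗) (γ , δ , z≗) =
    γ * α₁ + δ * α₂ , γ * β₁ + δ * β₂ , λ i →
      trans (z≗ i) (trans (cong₂ (λ s t → γ * s + δ * t) (x≗ i) (y≗ i))
        (solve 8 (λ γ δ α₁ β₁ α₂ β₂ p q → γ :* (α₁ :* p :+ β₁ :* q) :+ δ :* (α₂ :* p :+ β₂ :* q)
                                       := (γ :* α₁ :+ δ :* α₂) :* p :+ (γ :* β₁ :+ δ :* β₂) :* q)
               refl γ δ α₁ β₁ α₂ β₂ (u i) (v i)))

  Span⊆∈H : u ∈H ξ → v ∈H ξ → Span u v ⊆ (_∈H ξ)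
  Span⊆∈H {u = u} {ξ = ξ} {v = v} ξu≡0 ξv≡0 (γ , δ , y≗) =
    trans (·-cong (λ _ → refl) y≗) (trans (·-linʳ ξ γ u δ v) (zero-combination γ δ ξu≡0 ξv≡0))

  Span⊆Kernel : Kernel η₁ η₂ u → Kernel η₁ η₂ v → Span u v ⊆ Kernel η₁ η₂
  Span⊆Kernel (η₁u≡0 , η₂u≡0) (η₁v≡0 , η₂v≡0) y∈ = Span⊆∈H η₁u≡0 η₁v≡0 y∈ , Span⊆∈H η₂u≡0 η₂v≡0 y∈

  Span⇒Kernel⊆∈H : Span η₁ η₂ ξ → Kernel η₁ η₂ ⊆ (_∈H ξ)
  Span⇒Kernel⊆∈H {η₁ = η₁} {η₂} (γ , δ , ξ≗) {x} (η₁x≡0 , η₂x≡0) =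
    trans (·-cong ξ≗ (λ _ → refl)) (trans (·-linˡ γ η₁ δ η₂ x) (zero-combination γ δ η₁x≡0 η₂x≡0))

  Kernel-antitone : Span η₁ η₂ ⊆ Span η₁′ η₂′ → Kernel η₁′ η₂′ ⊆ Kernel η₁ η₂
  Kernel-antitone S⊆S′ x∈ = Span⇒Kernel⊆∈H (S⊆S′ Span-fst) x∈ , Span⇒Kernel⊆∈H (S⊆S′ Span-snd) x∈

  Span≐⇒Kernel≐ : Span η₁ η₂ ≐ Span η₁′ η₂′ → Kernel η₁ η₂ ≐ Kernel η₁′ η₂′
  Span≐⇒Kernel≐ (S⊆S′ , S′⊆S) = Kernel-antitone S′⊆S , Kernel-antitone S⊆S′

  Independent⇒NonZeroˡ : Independent u v → NonZero u
  Independent⇒NonZeroˡ {u = u} {v} ind =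
    ≢0ᵥ⇒NonZero λ u≗0 → 0≢1 (sym (proj₁ (ind 1# 0# λ i → trans (lin-1-0 u v i) (u≗0 i))))

  minor : Vect k → Vect k → Fin k → Vect k
  minor η₁ η₂ i j = η₁ i * η₂ j + - (η₂ i * η₁ j)

  Independent⇒minor-NonZero : Independent η₁ η₂ → ∃[ i ] NonZero (minor η₁ η₂ i)
  Independent⇒minor-NonZero {η₁ = η₁} {η₂} ind with Independent⇒NonZeroˡ ind
  ... | i , η₁ᵢ≢0 = i , ≢0ᵥ⇒NonZero λ minorᵢ≗0 → η₁ᵢ≢0 (proj₂ (ind (- η₂ i) (η₁ i) λ j →
        trans (solve 4 (λ a b c d → :- a :* b :+ c :* d := c :* d :+ :- (a :* b)) refl (η₂ i) (η₁ j) (η₁ i) (η₂ j))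
              (minorᵢ≗0 j)))

  record DualPair (η₁ η₂ : Vect k) : Set where
    field
      e₁ e₂ : Vect k
      η₁·e₁ : η₁ · e₁ ≡ 1#
      η₂·e₁ : η₂ · e₁ ≡ 0#
      η₁·e₂ : η₁ · e₂ ≡ 0#
      η₂·e₂ : η₂ · e₂ ≡ 1#

  -- e₁ and e₂ are supported on {i, j}; their entries there form the inverse of the minor.
  minor≢0⇒DualPair : ∀ {i j} → minor η₁ η₂ i j ≢ 0# → DualPair η₁ η₂
  minor≢0⇒DualPair {η₁ = η₁} {η₂} {i} {j} d≢0 with inverse _ d≢0
  ... | d⁻¹ , dd⁻¹≡1 = record { e₁ = e₁ ; e₂ = e₂ ; η₁·e₁ = η₁·e₁ ; η₂·e₁ = η₂·e₁ ; η₁·e₂ = η₁·e₂ ; η₂·e₂ = η₂·e₂ }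
    where
    ·-lin-idM : ∀ η p q → η · lin p (idM i) q (idM j) ≡ p * η i + q * η j
    ·-lin-idM η p q = trans (·-linʳ η p (idM i) q (idM j)) (cong₂ (λ s t → p * s + q * t) (·-idM η i) (·-idM η j))

    e₁ e₂ : Vect _
    e₁ = lin (d⁻¹ * η₂ j) (idM i) (- (d⁻¹ * η₂ i)) (idM j)
    e₂ = lin (- (d⁻¹ * η₁ j)) (idM i) (d⁻¹ * η₁ i) (idM j)

    η₁·e₁ : η₁ · e₁ ≡ 1#
    η₁·e₁ = trans (·-lin-idM η₁ (d⁻¹ * η₂ j) (- (d⁻¹ * η₂ i)))
      (trans (solve 5 (λ d⁻¹ a b c e → (d⁻¹ :* a) :* b :+ (:- (d⁻¹ :* c)) :* e := (b :* a :+ :- (c :* e)) :* d⁻¹)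
                      refl d⁻¹ (η₂ j) (η₁ i) (η₂ i) (η₁ j))
             dd⁻¹≡1)

    η₂·e₁ : η₂ · e₁ ≡ 0#
    η₂·e₁ = trans (·-lin-idM η₂ (d⁻¹ * η₂ j) (- (d⁻¹ * η₂ i)))
      (solve 3 (λ d⁻¹ a c → (d⁻¹ :* a) :* c :+ (:- (d⁻¹ :* c)) :* a := con (ℤ.+ 0)) refl d⁻¹ (η₂ j) (η₂ i))

    η₁·e₂ : η₁ · e₂ ≡ 0#
    η₁·e₂ = trans (·-lin-idM η₁ (- (d⁻¹ * η₁ j)) (d⁻¹ * η₁ i))
      (solve 3 (λ d⁻¹ a c → (:- (d⁻¹ :* a)) :* c :+ (d⁻¹ :* c) :* a := con (ℤ.+ 0)) refl d⁻¹ (η₁ j) (η₁ i))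

    η₂·e₂ : η₂ · e₂ ≡ 1#
    η₂·e₂ = trans (·-lin-idM η₂ (- (d⁻¹ * η₁ j)) (d⁻¹ * η₁ i))
      (trans (solve 5 (λ d⁻¹ a b c e → (:- (d⁻¹ :* a)) :* b :+ (d⁻¹ :* c) :* e := (c :* e :+ :- (b :* a)) :* d⁻¹)
                      refl d⁻¹ (η₁ j) (η₂ i) (η₁ i) (η₂ j))
             dd⁻¹≡1)

  DualPair⇒Span : DualPair η₁ η₂ → Kernel η₁ η₂ ⊆ (_∈H ξ) → Span η₁ η₂ ξ
  DualPair⇒Span {k} {η₁} {η₂} {ξ} D K⊆ξ = ξ · e₁ , ξ · e₂ , coordinate
    where
    open DualPair D
    residual : Fin k → Vect k
    residual m = lin 1# (idM m) (- 1#) (lin (η₁ m) e₁ (η₂ m) e₂)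

    ·-residual : ∀ η m → η · residual m ≡ η m + - (η₁ m * (η · e₁) + η₂ m * (η · e₂))
    ·-residual η m = begin
      η · residual m
        ≡⟨ ·-linʳ η 1# (idM m) (- 1#) (lin (η₁ m) e₁ (η₂ m) e₂) ⟩
      1# * (η · idM m) + - 1# * (η · lin (η₁ m) e₁ (η₂ m) e₂)
        ≡⟨ cong₂ (λ s t → 1# * s + - 1# * t) (·-idM η m) (·-linʳ η (η₁ m) e₁ (η₂ m) e₂) ⟩
      1# * η m + - 1# * (η₁ m * (η · e₁) + η₂ m * (η · e₂))
        ≡⟨ solve 2 (λ s t → con (ℤ.+ 1) :* s :+ :- con (ℤ.+ 1) :* t := s :+ :- t)
                   refl (η m) (η₁ m * (η · e₁) + η₂ m * (η · e₂)) ⟩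
      η m + - (η₁ m * (η · e₁) + η₂ m * (η · e₂)) ∎

    residual∈Kernel : ∀ m → Kernel η₁ η₂ (residual m)
    residual∈Kernel m =
      trans (·-residual η₁ m) (trans (cong₂ (λ s t → η₁ m + - (η₁ m * s + η₂ m * t)) η₁·e₁ η₁·e₂)
        (solve 2 (λ p q → p :+ :- (p :* con (ℤ.+ 1) :+ q :* con (ℤ.+ 0)) := con (ℤ.+ 0)) refl (η₁ m) (η₂ m))) ,
      trans (·-residual η₂ m) (trans (cong₂ (λ s t → η₂ m + - (η₁ m * s + η₂ m * t)) η₂·e₁ η₂·e₂)
        (solve 2 (λ p q → q :+ :- (p :* con (ℤ.+ 0) :+ q :* con (ℤ.+ 1)) := con (ℤ.+ 0)) refl (η₁ m) (η₂ m)))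

    coordinate : ξ ≗ lin (ξ · e₁) η₁ (ξ · e₂) η₂
    coordinate m = begin
      ξ m                                  ≡⟨ x∙y⁻¹≈ε⇒x≈y _ _ ξ·residual≡0 ⟩
      η₁ m * (ξ · e₁) + η₂ m * (ξ · e₂)    ≡⟨ cong₂ _+_ (*-comm (η₁ m) _) (*-comm (η₂ m) _) ⟩
      (ξ · e₁) * η₁ m + (ξ · e₂) * η₂ m    ∎
      where
      ξ·residual≡0 : ξ m + - (η₁ m * (ξ · e₁) + η₂ m * (ξ · e₂)) ≡ 0#
      ξ·residual≡0 = trans (sym (·-residual ξ m)) (K⊆ξ (residual∈Kernel m))

  Kernel⊆∈H⇒Span : Independent η₁ η₂ → Kernel η₁ η₂ ⊆ (_∈H ξ) → Span η₁ η₂ ξ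
  Kernel⊆∈H⇒Span ind =
    let i , j , minorᵢⱼ≢0 = Independent⇒minor-NonZero ind
    in  DualPair⇒Span (minor≢0⇒DualPair {i = i} {j} minorᵢⱼ≢0)

  module QuadraticOperator
    {k : ℕ} (f : Vect k → Vect k)
    (f-cong : ∀ {x y} → x ≗ y → f x ≗ f y)
    (f-lin : ∀ α u β v → f (lin α u β v) ≗ lin α (f u) β (f v))
    {a b : F} (f² : ∀ u → f (f u) ≗ lin a (f u) b u)
    (irreducible : IrreducibleQuadratic a b)
    where

    f-zero : x ≗ 0ᵥ → f x ≗ 0ᵥ
    f-zero {x} x≗0 i = begin
      f x i                    ≡⟨ f-cong (λ j → trans (x≗0 j) (sym (lin-0-0 x x j))) i ⟩
      f (lin 0# x 0# x) i      ≡⟨ f-lin 0# x 0# x i ⟩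
      lin 0# (f x) 0# (f x) i  ≡⟨ lin-0-0 (f x) (f x) i ⟩
      0#                       ∎

    f-coordinates : x ≗ lin α u β (f u) → f x ≗ lin (β * b) u (α + β * a) (f u)
    f-coordinates {x} {α} {u} {β} x≗ i = begin
      f x i                                      ≡⟨ f-cong x≗ i ⟩
      f (lin α u β (f u)) i                      ≡⟨ f-lin α u β (f u) i ⟩
      α * f u i + β * f (f u) i                  ≡⟨ cong (λ s → α * f u i + β * s) (f² u i) ⟩
      α * f u i + β * (a * f u i + b * u i)
        ≡⟨ solve 6 (λ α w β a b v → α :* w :+ β :* (a :* w :+ b :* v) := (β :* b) :* v :+ (α :+ β :* a) :* w)
                   refl α (f u i) β a b (u i) ⟩
      (β * b) * u i + (α + β * a) * f u i        ∎

    norm-combination : x ≗ lin α u β (f u) → lin (α + β * a) x (- β) (f x) ≗ λ i → norm a b α β * u i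
    norm-combination {x} {α} {u} {β} x≗ i = begin
      (α + β * a) * x i + - β * f x i
        ≡⟨ cong₂ (λ s t → (α + β * a) * s + - β * t) (x≗ i) (f-coordinates x≗ i) ⟩
      (α + β * a) * (α * u i + β * f u i) + - β * ((β * b) * u i + (α + β * a) * f u i)
        ≡⟨ solve 6 (λ α β a b v w → (α :+ β :* a) :* (α :* v :+ β :* w) :+ :- β :* ((β :* b) :* v :+ (α :+ β :* a) :* w)
                                  := (α :* (α :+ β :* a) :+ :- (β :* (β :* b))) :* v)
                   refl α β a b (u i) (f u i) ⟩
      norm a b α β * u i ∎

    independent : NonZero u → Independent u (f u)
    independent {u} (i , uᵢ≢0) α β comb≗0 = norm≡0⇒trivial irreducible (x*y≡0⇒x≡0 Nuᵢ≡0 uᵢ≢0)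
      where
      Nuᵢ≡0 : norm a b α β * u i ≡ 0#
      Nuᵢ≡0 = trans (sym (norm-combination {x = lin α u β (f u)} (λ _ → refl) i))
                    (zero-combination (α + β * a) (- β) (comb≗0 i) (f-zero comb≗0 i))

    generator∈Span : NonZero x → x ≗ lin α u β (f u) → Span x (f x) u
    generator∈Span {x} {α} {u} {β} x≢0 x≗ =
      let N⁻¹ , NN⁻¹≡1 = inverse (norm a b α β) N≢0 in
      N⁻¹ * (α + β * a) , N⁻¹ * - β , λ i → begin
        u i
          ≡⟨ *-identityˡ (u i) ⟨
        1# * u i
          ≡⟨ cong (_* u i) NN⁻¹≡1 ⟨
        (norm a b α β * N⁻¹) * u i
          ≡⟨ solve 3 (λ n n⁻¹ w → (n :* n⁻¹) :* w := n⁻¹ :* (n :* w)) refl (norm a b α β) N⁻¹ (u i) ⟩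
        N⁻¹ * (norm a b α β * u i)
          ≡⟨ cong (N⁻¹ *_) (norm-combination x≗ i) ⟨
        N⁻¹ * ((α + β * a) * x i + - β * f x i)
          ≡⟨ solve 5 (λ n⁻¹ s t p q → n⁻¹ :* (s :* p :+ t :* q) := (n⁻¹ :* s) :* p :+ (n⁻¹ :* t) :* q)
                     refl N⁻¹ (α + β * a) (- β) (x i) (f x i) ⟩
        (N⁻¹ * (α + β * a)) * x i + (N⁻¹ * - β) * f x i ∎
      where
      N≢0 : norm a b α β ≢ 0#
      N≢0 N≡0 = NonZero⇒≢0ᵥ x≢0 λ i →
        let α≡0 , β≡0 = norm≡0⇒trivial irreducible N≡0 in
        trans (x≗ i) (trans (cong₂ (λ s t → s * u i + t * f u i) α≡0 β≡0) (lin-0-0 u (f u) i))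

    Span-invariant : Span u (f u) y → Span u (f u) (f y)
    Span-invariant (α , β , y≗) = β * b , α + β * a , f-coordinates y≗

    Span-through : NonZero x → Span u (f u) x → Span x (f x) ≐ Span u (f u)
    Span-through {x = x} {u = u} x≢0 x∈@(_ , _ , x≗) =
      Span⊆Span x∈ (Span-invariant x∈) , Span⊆Span u∈ (Span-invariant u∈)
      where
      u∈ : Span x (f x) u
      u∈ = generator∈Span x≢0 x≗

  module Spread
    {k : ℕ} (M : Mat k)
    {a b : F} (M² : (M ∘ₘ M) ≈M ((a ⋆ M) ⊕ (b ⋆ idM)))
    (irreducible : IrreducibleQuadratic a b)
    where

    private
      module Col = QuadraticOperator (M ▸_) (▸-cong M) (▸-lin M) (▸-quadratic M²) irreducible
      module Row = QuadraticOperator (_◂ M) (◂-cong M) (◂-lin M) (◂-quadratic M²) irreducible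

    S : Line k → Set
    S (line u v _) = NonZero u × v ≗ M ▸ u

    S* : Codim2 k → Set
    S* (codim2 η₁ η₂ _) = NonZero η₁ × η₂ ≗ η₁ ◂ M

    lineThrough : ∀ {x : Vect k} → NonZero x → Line k
    lineThrough {x} x≢0 = line x (M ▸ x) (Col.independent x≢0)

    lineThrough∈S : ∀ {x : Vect k} (x≢0 : NonZero x) → S (lineThrough x≢0)
    lineThrough∈S x≢0 = x≢0 , λ _ → refl

    S-Span≐ : v ≗ M ▸ u → NonZero x → Span u v x → Span u v ≐ Span x (M ▸ x)
    S-Span≐ v≗Mu x≢0 x∈ =
      ≐-trans (Span-congʳ v≗Mu) (≐-sym (Col.Span-through x≢0 (proj₁ (Span-congʳ v≗Mu) x∈)))

    isLineSpread : IsLineSpread S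
    isLineSpread = covers , coincide
      where
      covers : ∀ x → NonZero x → ∃[ ℓ ] (S ℓ × x ∈L ℓ)
      covers x x≢0 = lineThrough x≢0 , lineThrough∈S x≢0 , Span-fst
      coincide : ∀ ℓ m x → S ℓ → S m → NonZero x → x ∈L ℓ → x ∈L m → ℓ ≡L m
      coincide (line _ _ _) (line _ _ _) x (_ , v≗Mu) (_ , v′≗Mu′) x≢0 x∈ℓ x∈m =
        ≐⇒pointwise (≐-trans (S-Span≐ v≗Mu x≢0 x∈ℓ) (≐-sym (S-Span≐ v′≗Mu′ x≢0 x∈m)))

    Kernel-▸-invariant : Kernel η₁ (η₁ ◂ M) x → Kernel η₁ (η₁ ◂ M) (M ▸ x)
    Kernel-▸-invariant {η₁ = η} {x = x} (ηx≡0 , ηMx≡0) = trans (·▸≡◂· η M x) ηMx≡0 , (begin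
      (η ◂ M) · (M ▸ x)                ≡⟨ ·▸≡◂· (η ◂ M) M x ⟩
      ((η ◂ M) ◂ M) · x                ≡⟨ ·-cong (◂-quadratic M² η) (λ _ → refl) ⟩
      lin a (η ◂ M) b η · x            ≡⟨ ·-linˡ a (η ◂ M) b η x ⟩
      a * ((η ◂ M) · x) + b * (η · x)  ≡⟨ zero-combination a b ηMx≡0 ηx≡0 ⟩
      0#                               ∎)

    S*-Kernel≐ : Independent η₁ η₂ → η₂ ≗ η₁ ◂ M → NonZero ξ → Kernel η₁ η₂ ⊆ (_∈H ξ) →
                 Kernel η₁ η₂ ≐ Kernel ξ (ξ ◂ M)
    S*-Kernel≐ {η₁ = η₁} {η₂} {ξ = ξ} ind η₂≗η₁M ξ≢0 K⊆ξ = ≐-sym (Span≐⇒Kernel≐ spans)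
      where
      spans : Span ξ (ξ ◂ M) ≐ Span η₁ η₂
      spans = ≐-trans (Row.Span-through ξ≢0 (proj₁ (Span-congʳ η₂≗η₁M) (Kernel⊆∈H⇒Span ind K⊆ξ)))
                      (≐-sym (Span-congʳ η₂≗η₁M))

    isDual : IsDual S S*
    isDual = contained , coincide , partitioned
      where
      contained : ∀ ξ → NonZero ξ → ∃[ L ] (S* L × L ⊆CH ξ)
      contained ξ ξ≢0 = codim2 ξ (ξ ◂ M) (Row.independent ξ≢0) , (ξ≢0 , λ _ → refl) , λ _ → proj₁
      coincide : ∀ ξ L L′ → NonZero ξ → S* L → S* L′ → L ⊆CH ξ → L′ ⊆CH ξ → L ≡C L′
      coincide ξ (codim2 _ _ ind) (codim2 _ _ ind′) ξ≢0 (_ , η₂≗η₁M) (_ , η₂′≗η₁′M) L⊆ξ L′⊆ξ =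
        ≐⇒pointwise (≐-trans (S*-Kernel≐ ind η₂≗η₁M ξ≢0 (L⊆ξ _))
                             (≐-sym (S*-Kernel≐ ind′ η₂′≗η₁′M ξ≢0 (L′⊆ξ _))))
      partitioned : ∀ L x → S* L → NonZero x → x ∈C L → ∃[ ℓ ] (S ℓ × ℓ ⊆LC L × x ∈L ℓ)
      partitioned (codim2 η₁ η₂ _) x (_ , η₂≗η₁M) x≢0 x∈L =
        lineThrough x≢0 , lineThrough∈S x≢0 , (λ _ → Span⊆Kernel x∈L Mx∈L) , Span-fst
        where
        Kernel≐ : Kernel η₁ η₂ ≐ Kernel η₁ (η₁ ◂ M)
        Kernel≐ = Span≐⇒Kernel≐ (Span-congʳ η₂≗η₁M)
        Mx∈L : Kernel η₁ η₂ (M ▸ x)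
        Mx∈L = proj₂ Kernel≐ (Kernel-▸-invariant (proj₁ Kernel≐ x∈L))

    InHM⇔InSpreadType : ∀ x ξ → PointΓ x ξ →
                        (InHM M x ξ → InSpreadType S x ξ) × (InSpreadType S x ξ → InHM M x ξ)
    InHM⇔InSpreadType x ξ (x≢0 , _ , ξx≡0) = to , from
      where
      to : InHM M x ξ → InSpreadType S x ξ
      to ξMx≡0 (line u v _) (_ , v≗Mu) x∈ℓ _ y∈ℓ = Span⊆∈H ξx≡0 ξMx≡0 (proj₁ (S-Span≐ v≗Mu x≢0 x∈ℓ) y∈ℓ)
      from : InSpreadType S x ξ → InHM M x ξ
      from ℓ⊆ξ = ℓ⊆ξ (lineThrough x≢0) (lineThrough∈S x≢0) Span-fst (M ▸ x) Span-snd

    isSpreadTypeHyperplane : IsSpreadTypeHyperplane (InHM M)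
    isSpreadTypeHyperplane = S , S* , isLineSpread , isDual , InHM⇔InSpreadType

proposition3p18 : (𝔽 : FiniteField) (n : ℕ) → let open Geometry 𝔽 in
    (M : Mat (suc n)) → NotScalar M → MaxWeight M → MinPolyIrreducibleDeg2 M →
    IsSpreadTypeHyperplane (InHM M)
proposition3p18 𝔽 n M _ _ (a , b , (M² , _) , irreducible) =
  Spread.isSpreadTypeHyperplane 𝔽 M M² irreducible
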